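{- Let $r$ and $s$ be non-negative integers with $r\ge 3s+6$. Then $F_v(2_r;r-s-1)\le r+2s+7$.
   Context: All graphs are finite, undirected, without loops or multiple edges. $\omega(G)$ is the clique number of $G$. $G\to^v(2_r)$ means that every partition of $V(G)$ into $r$ pairwise disjoint (possibly empty) classes has a class containing an edge, i.e. $\chi(G)\ge r+1$. $H_v(2_r;q)$ is the set of graphs $G$ with $G\to^v(2_r)$ and $\omega(G)<q$, and $F_v(2_r;q)=\min\{|V(G)|:G\in H_v(2_r;q)\}$ (it exists whenever $q\ge 3$). -}

module Defs where

open import Data.Nat using (ℕ; _≤_; _<_)
open import Data.Fin using (Fin)
open import Data.Bool using (Bool; true; false)
open import Data.Product using (Σ; _×_; ∃; ∃-syntax)
open import Relation.Binary.PropositionalEquality using (_≡_; _≢_)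
open import Relation.Nullary using (¬_)

record Graph (n : ℕ) : Set where
  field
    adj   : Fin n → Fin n → Bool
    sym   : ∀ u v → adj u v ≡ adj v u
    irrefl : ∀ v → adj v v ≡ false
open Graph public

Adj : ∀ {n} → Graph n → Fin n → Fin n → Set
Adj G u v = adj G u v ≡ true

IsClique : ∀ {n} (G : Graph n) {k : ℕ} → (Fin k → Fin n) → Set
IsClique G {k} f = ∀ (i j : Fin k) → i ≢ j → Adj G (f i) (f j)

CliqueNumberLT : ∀ {n} → Graph n → ℕ → Set
CliqueNumberLT G q = ¬ (Σ (Fin q → Fin _) λ f → IsClique G f)

-- G →v (2_r): every partition of V(G) into r (possibly empty) classes
-- (a map V(G) → Fin r) has a class containing an edge.
VArrow : ∀ {n} → Graph n → ℕ → Set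
VArrow {n} G r = ∀ (c : Fin n → Fin r) → ∃[ u ] ∃[ v ] (Adj G u v × c u ≡ c v)

InHv : ∀ {n} → Graph n → ℕ → ℕ → Set
InHv G r q = VArrow G r × CliqueNumberLT G q

-- F_v(2_r; q) ≤ m  ⇔  some graph in H_v(2_r; q) has at most m vertices.
FvLE : ℕ → ℕ → ℕ → Set
FvLE r q m = ∃[ n ] (n ≤ m × Σ (Graph n) λ G → InHv G r q)

module Submission where

-- Write r = t + (3s+6).  The witness is the join
--     K₁ + … + K₁ (t copies) + C₅ + … + C₅ (s copies) + Q,
-- where Q is the circulant graph on ℤ₁₃ with connection set {±2,±3,±4,±6}.
-- It has t + 5s + 13 = r + 2s + 7 vertices, and:
--  * colours: Q has no independent 3-set and 13 > 2·6, so Q →v (2_6); joining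
--    a graph that forces k distinct colours in every proper colouring (K₁: 1,
--    C₅: 3) raises the arrowing number by k, giving t + 3s + 6 = r;
--  * cliques: ω(G + H) ≤ ω(G) + ω(H), with ω(K₁)=1, ω(C₅)=2, ω(Q)=4,
--    giving ω < t + 2s + 5 = r - s - 1.
-- The file first develops colourings (squeezing out unused colours), the join
-- and its arrowing and clique bounds, then a pigeonhole lemma for graphs
-- without independent 3-sets, a computational clique test for the concrete
-- small graphs, and finally assembles the witness.

open import Defs hiding (sym)
open import Data.Nat using (ℕ; zero; suc; _≤_; _<_; s≤s; _+_; _*_; _∸_; ∣_-_∣; _≤?_)
open import Data.Nat.Properties
  using (module ≤-Reasoning; ≤-refl; ∣-∣-comm; ∣n-n∣≡0; ≤-reflexive; ≤-pred; ≤-<-trans; m≤m+n; m∸n+n≡m; m+n∸m≡n;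
         +-suc; +-assoc; *-suc; +-cancelˡ-≤; +-monoˡ-≤; ≰⇒>)
open import Data.Nat.Tactic.RingSolver using (solve-∀)
open import Data.Fin using (Fin; zero; suc; toℕ; punchIn; punchOut; _↑ˡ_; _↑ʳ_; splitAt; _≟_; inject≤)
open import Data.Fin.Properties
  using (suc-injective; punchOut-injective; punchIn-injective; punchInᵢ≢i; punchIn-punchOut;
         any?; pigeonhole; <⇒≢; inject≤-injective; splitAt-↑ˡ; splitAt-↑ʳ)
open import Data.Vec.Functional using ([]; _∷_)
open import Data.Bool using (Bool; true; false; _∧_; _∨_; not; if_then_else_)
open import Data.Product using (Σ; _,_; ∃-syntax; _×_)
open import Data.Sum using (_⊎_; inj₁; inj₂)
open import Data.Empty using (⊥; ⊥-elim)
open import Relation.Binary.PropositionalEquality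
open import Relation.Binary.Definitions using (Symmetric)
open import Relation.Nullary using (yes; no)
open import Relation.Nullary.Decidable using (⌊_⌋)
open import Function using (_∘_)
open import Function.Definitions using (Injective)

private
  variable
    m n k p q r : ℕ

EdgeMono : Graph n → (Fin n → Fin k) → Set
EdgeMono G c = ∃[ u ] ∃[ v ] (Adj G u v × c u ≡ c v)

Distinct : {A : Set} → (Fin k → A) → Set
Distinct w = ∀ i j → i ≢ j → w i ≢ w j

edgeMono-coarsen : {G : Graph n} {c : Fin n → Fin k} {c′ : Fin n → Fin p} →
  (∀ {u v} → c′ u ≡ c′ v → c u ≡ c v) → EdgeMono G c′ → EdgeMono G c
edgeMono-coarsen coarse (u , v , uv , e) = u , v , uv , coarse e

edgeMono-embed : {G : Graph m} {H : Graph n} {c : Fin n → Fin k} (φ : Fin m → Fin n) →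
  (∀ {u v} → Adj G u v → Adj H (φ u) (φ v)) → EdgeMono G (c ∘ φ) → EdgeMono H c
edgeMono-embed φ hom (u , v , uv , e) = φ u , φ v , hom uv , e

squeeze : {a : Fin (suc k)} (c : Fin n → Fin (suc k)) → (∀ u → a ≢ c u) → Fin n → Fin k
squeeze c avoids u = punchOut (avoids u)

squeeze-reflects : {a : Fin (suc k)} (c : Fin n → Fin (suc k)) (avoids : ∀ u → a ≢ c u) →
  ∀ {u v} → squeeze c avoids u ≡ squeeze c avoids v → c u ≡ c v
squeeze-reflects c avoids {u} {v} = punchOut-injective (avoids u) (avoids v)

-- If G →v (2_r), then every (k + r)-colouring of G that avoids k distinct
-- colours has a monochromatic edge (squeeze the avoided colours out one by one).
avoidColours : {r : ℕ} {G : Graph n} → VArrow G r → ∀ k (c : Fin n → Fin (k + r))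
  (a : Fin k → Fin (k + r)) → Distinct a → (∀ i u → a i ≢ c u) → EdgeMono G c
avoidColours arrow zero c a distinct avoids = arrow c
avoidColours {r = r} {G = G} arrow (suc k) c a distinct avoids =
  edgeMono-coarsen {G = G} (squeeze-reflects c (avoids zero))
    (avoidColours {r = r} {G = G} arrow k (squeeze c (avoids zero)) a′ distinct′ avoids′)
  where
  a₀≢ : ∀ i → a zero ≢ a (suc i)
  a₀≢ i = distinct zero (suc i) λ ()
  a′ : Fin k → Fin (k + r)
  a′ i = punchOut (a₀≢ i)
  distinct′ : Distinct a′
  distinct′ i j i≢j e = distinct (suc i) (suc j) (i≢j ∘ suc-injective) (punchOut-injective (a₀≢ i) (a₀≢ j) e)
  avoids′ : ∀ i u → a′ i ≢ squeeze c (avoids zero) u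
  avoids′ i u e = avoids (suc i) u (punchOut-injective (a₀≢ i) (avoids zero u) e)

ForcesColours : Graph m → ℕ → Set
ForcesColours {m} G k = ∀ {p} (c : Fin m → Fin p) →
  EdgeMono G c ⊎ Σ (Fin k → Fin m) λ w → Distinct (c ∘ w)

record Selection {V Z : Set} (tag : V → Z) (f : Fin q → Z) : Set where
  field
    size    : ℕ
    pos     : Fin size → Fin q
    pos-inj : Injective _≡_ _≡_ pos
    val     : Fin size → V
    spec    : ∀ i → f (pos i) ≡ tag (val i)
open Selection

shift : {V Z : Set} {tag : V → Z} {f : Fin (suc q) → Z} →
  Selection tag (f ∘ suc) → Selection tag f
shift S = record
  { size = size S ; pos = suc ∘ pos S ; pos-inj = pos-inj S ∘ suc-injective
  ; val = val S ; spec = spec S }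

extend : {V Z : Set} {tag : V → Z} {f : Fin (suc q) → Z} {x : V} →
  f zero ≡ tag x → Selection tag (f ∘ suc) → Selection tag f
extend {x = x} head S = record
  { size = suc (size S) ; pos = zero ∷ (suc ∘ pos S) ; pos-inj = injective
  ; val = x ∷ val S ; spec = λ { zero → head ; (suc i) → spec S i } }
  where
  injective : Injective _≡_ _≡_ (zero ∷ (suc ∘ pos S))
  injective {zero}  {zero}  _ = refl
  injective {suc i} {suc j} e = cong suc (pos-inj S (suc-injective e))

record Sorting {X Y : Set} (f : Fin q → X ⊎ Y) : Set where
  field
    lefts  : Selection inj₁ f
    rights : Selection inj₂ f
    total  : size lefts + size rights ≡ q

sort : {X Y : Set} (f : Fin q → X ⊎ Y) → Sorting f
sort {zero} f = record { lefts = none ; rights = none ; total = refl }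
  where
  none : ∀ {V Z : Set} {tag : V → Z} {f : Fin 0 → Z} → Selection tag f
  none = record { size = 0 ; pos = λ () ; pos-inj = λ { {()} } ; val = λ () ; spec = λ () }
sort {suc q} f with sort (f ∘ suc) | f zero in head
... | record { lefts = L ; rights = R ; total = t } | inj₁ x =
  record { lefts = extend head L ; rights = shift R ; total = cong suc t }
... | record { lefts = L ; rights = R ; total = t } | inj₂ y =
  record { lefts = shift L ; rights = extend head R ; total = trans (+-suc (size L) (size R)) (cong suc t) }

split-large : ∀ A B a b → a + b ≡ suc (A + B) → a ≤ A → suc B ≤ b
split-large A B a b total a≤A = +-cancelˡ-≤ A (suc B) b (begin
  A + suc B ≡⟨ +-suc A B ⟩
  suc (A + B) ≡⟨ sym total ⟩
  a + b ≤⟨ +-monoˡ-≤ b a≤A ⟩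
  A + b ∎)
  where open ≤-Reasoning

module Join {m n : ℕ} (G : Graph m) (H : Graph n) where

  joinAdj : Fin m ⊎ Fin n → Fin m ⊎ Fin n → Bool
  joinAdj (inj₁ u) (inj₁ v) = adj G u v
  joinAdj (inj₂ u) (inj₂ v) = adj H u v
  joinAdj _        _        = true

  joinAdj-sym : ∀ x y → joinAdj x y ≡ joinAdj y x
  joinAdj-sym (inj₁ u) (inj₁ v) = Graph.sym G u v
  joinAdj-sym (inj₁ u) (inj₂ v) = refl
  joinAdj-sym (inj₂ u) (inj₁ v) = refl
  joinAdj-sym (inj₂ u) (inj₂ v) = Graph.sym H u v

  joinAdj-irrefl : ∀ x → joinAdj x x ≡ false
  joinAdj-irrefl (inj₁ u) = irrefl G u
  joinAdj-irrefl (inj₂ u) = irrefl H u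

  join : Graph (m + n)
  join = record
    { adj    = λ u v → joinAdj (splitAt m u) (splitAt m v)
    ; sym    = λ u v → joinAdj-sym (splitAt m u) (splitAt m v)
    ; irrefl = λ u → joinAdj-irrefl (splitAt m u) }

  adj-left : ∀ {u v} → Adj G u v → Adj join (u ↑ˡ n) (v ↑ˡ n)
  adj-left {u} {v} uv rewrite splitAt-↑ˡ m u n | splitAt-↑ˡ m v n = uv

  adj-right : ∀ {u v} → Adj H u v → Adj join (m ↑ʳ u) (m ↑ʳ v)
  adj-right {u} {v} uv rewrite splitAt-↑ʳ m n u | splitAt-↑ʳ m n v = uv

  adj-across : ∀ u v → Adj join (u ↑ˡ n) (m ↑ʳ v)
  adj-across u v rewrite splitAt-↑ˡ m u n | splitAt-↑ʳ m n v = refl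

  -- χ(G + H) ≥ χ(G) + χ(H): a (k + r)-colouring shows k distinct colours on
  -- G; if one of them reappears on H we get a monochromatic cross edge,
  -- otherwise H is coloured while avoiding k colours.
  join-arrow : ∀ {k r} → ForcesColours G k → VArrow H r → VArrow join (k + r)
  join-arrow {k} {r} forces arrow c with forces (c ∘ (_↑ˡ n))
  ... | inj₁ mono = edgeMono-embed {G = G} {H = join} {c = c} (_↑ˡ n) adj-left mono
  ... | inj₂ (w , distinct) with any? (λ i → any? (λ v → c (w i ↑ˡ n) ≟ c (m ↑ʳ v)))
  ...   | yes (i , v , same) = w i ↑ˡ n , m ↑ʳ v , adj-across (w i) v , same
  ...   | no none = edgeMono-embed {G = H} {H = join} {c = c} (m ↑ʳ_) adj-right
            (avoidColours {r = r} {G = H} arrow k (c ∘ (m ↑ʳ_)) (c ∘ (_↑ˡ n) ∘ w) distinct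
              λ i v same → none (i , v , same))

  selection-clique : ∀ {q p ℓ} {K : Graph ℓ} {tag : Fin ℓ → Fin m ⊎ Fin n} →
    (∀ x y → joinAdj (tag x) (tag y) ≡ adj K x y) →
    {f : Fin q → Fin (m + n)} → IsClique join f → (S : Selection tag (splitAt m ∘ f)) →
    (ι : Fin p → Fin (size S)) → Injective _≡_ _≡_ ι → IsClique K (val S ∘ ι)
  selection-clique side clique S ι ι-inj i j i≢j =
    trans (sym (side _ _))
      (subst₂ (λ x y → joinAdj x y ≡ true) (spec S (ι i)) (spec S (ι j))
        (clique _ _ (i≢j ∘ ι-inj ∘ pos-inj S)))

  -- ω(G + H) ≤ ω(G) + ω(H): a clique of size 1 + A + B has more than A
  -- vertices in G or more than B vertices in H.
  join-ω : ∀ {A B} → CliqueNumberLT G (suc A) → CliqueNumberLT H (suc B) →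
    CliqueNumberLT join (suc (A + B))
  join-ω {A} {B} noG noH (f , clique) with sort (splitAt m ∘ f)
  ... | record { lefts = L ; rights = R ; total = total } with suc A ≤? size L
  ...   | yes large = noG (_ , selection-clique {K = G} (λ _ _ → refl) clique L (λ i → inject≤ i large)
                             (inject≤-injective large large _ _))
  ...   | no small = noH (_ , selection-clique {K = H} (λ _ _ → refl) clique R (λ i → inject≤ i large)
                            (inject≤-injective large large _ _))
    where
    large : suc B ≤ size R
    large = split-large A B (size L) (size R) total (≤-pred (≰⇒> small))

open Join using (join; join-arrow; join-ω)

stack : ℕ → ℕ → ℕ → ℕ
stack m zero    n = n
stack m (suc s) n = m + stack m s n

stack-≡ : ∀ m s n → stack m s n ≡ s * m + n
stack-≡ m zero    n = refl
stack-≡ m (suc s) n = trans (cong (m +_) (stack-≡ m s n)) (sym (+-assoc m (s * m) n))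

joinPower : Graph m → (s : ℕ) → Graph n → Graph (stack m s n)
joinPower H zero    G = G
joinPower H (suc s) G = join H (joinPower H s G)

joinPower-arrow : ∀ {H : Graph m} {G : Graph n} → ForcesColours H k → VArrow G r →
  ∀ s → VArrow (joinPower H s G) (stack k s r)
joinPower-arrow forces arrow zero    = arrow
joinPower-arrow forces arrow (suc s) = join-arrow _ _ forces (joinPower-arrow forces arrow s)

joinPower-ω : ∀ {A B} {H : Graph m} {G : Graph n} → CliqueNumberLT H (suc B) →
  CliqueNumberLT G (suc A) → ∀ s → CliqueNumberLT (joinPower H s G) (suc (stack B s A))
joinPower-ω noH noG zero    = noG
joinPower-ω noH noG (suc s) = join-ω _ _ noH (joinPower-ω noH noG s)

record MonoTriple (f : Fin n → Fin k) : Set where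
  constructor triple
  field
    x y z    : Fin n
    x≢y      : x ≢ y
    x≢z      : x ≢ z
    y≢z      : y ≢ z
    fx≡fy    : f x ≡ f y
    fx≡fz    : f x ≡ f z

skipTwo : ∀ {n} {i j : Fin (suc (suc n))} → i ≢ j →
  Σ (Fin n → Fin (suc (suc n))) λ g → Injective _≡_ _≡_ g × (∀ x → g x ≢ i) × (∀ x → g x ≢ j)
skipTwo {n} {i} {j} i≢j = g , g-inj , g≢i , g≢j
  where
  g : Fin n → Fin (suc (suc n))
  g x = punchIn i (punchIn (punchOut i≢j) x)
  g-inj : Injective _≡_ _≡_ g
  g-inj e = punchIn-injective (punchOut i≢j) _ _ (punchIn-injective i _ _ e)
  g≢i : ∀ x → g x ≢ i
  g≢i x = punchInᵢ≢i i _
  g≢j : ∀ x → g x ≢ j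
  g≢j x e = punchInᵢ≢i (punchOut i≢j) x
    (punchIn-injective i _ _ (trans e (sym (punchIn-punchOut i≢j))))

double-suc< : ∀ k n → 2 * suc k < suc (suc n) → 2 * k < n
double-suc< k n h rewrite *-suc 2 k = ≤-pred (≤-pred h)

-- Take two points of equal colour; either a third point has
-- their colour, or the remaining points use only k - 1 colours.
monoTriple : ∀ k n → 2 * k < n → (f : Fin n → Fin k) → MonoTriple f
monoTriple zero          (suc n)       _ f with f zero
... | ()
monoTriple (suc k)       (suc zero)    (s≤s ()) f
monoTriple (suc k)       (suc (suc n)) h f
  with pigeonhole (≤-<-trans (m≤m+n (suc k) _) h) f
... | i , j , i<j , fi≡fj with skipTwo {i = i} {j} (<⇒≢ i<j)
... | g , g-inj , g≢i , g≢j with any? (λ x → f (g x) ≟ f i)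
...   | yes (x , fgx≡fi) =
  triple i j (g x) (<⇒≢ i<j) (≢-sym (g≢i x)) (≢-sym (g≢j x)) fi≡fj (sym fgx≡fi)
...   | no none = lift (monoTriple k n (double-suc< k n h) (squeeze (f ∘ g) avoids))
  where
  avoids : ∀ x → f i ≢ f (g x)
  avoids x e = none (x , sym e)
  lift : MonoTriple (squeeze (f ∘ g) avoids) → MonoTriple f
  lift (triple x y z x≢y x≢z y≢z fx≡fy fx≡fz) =
    triple (g x) (g y) (g z) (x≢y ∘ g-inj) (x≢z ∘ g-inj) (y≢z ∘ g-inj)
      (squeeze-reflects (f ∘ g) avoids fx≡fy) (squeeze-reflects (f ∘ g) avoids fx≡fz)

complement : Graph n → Graph n
complement G = record
  { adj    = λ u v → if ⌊ u ≟ v ⌋ then false else not (adj G u v)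
  ; sym    = symmetric
  ; irrefl = irreflexive }
  where
  symmetric : ∀ u v → (if ⌊ u ≟ v ⌋ then false else not (adj G u v))
                    ≡ (if ⌊ v ≟ u ⌋ then false else not (adj G v u))
  symmetric u v with u ≟ v | v ≟ u
  ... | yes _   | yes _   = refl
  ... | no _    | no _    = cong not (Graph.sym G u v)
  ... | yes u≡v | no v≢u  = ⊥-elim (v≢u (sym u≡v))
  ... | no u≢v  | yes v≡u = ⊥-elim (u≢v (sym v≡u))
  irreflexive : ∀ v → (if ⌊ v ≟ v ⌋ then false else not (adj G v v)) ≡ false
  irreflexive v with v ≟ v
  ... | yes _  = refl
  ... | no v≢v = ⊥-elim (v≢v refl)

complement-adj : {G : Graph n} {u v : Fin n} → u ≢ v → adj G u v ≡ false → Adj (complement G) u v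
complement-adj {u = u} {v} u≢v nonadjacent with u ≟ v
... | yes u≡v = ⊥-elim (u≢v u≡v)
... | no _    = cong not nonadjacent

pairwise3 : {A : Set} {R : A → A → Set} → Symmetric R → ∀ {a b c} →
  R a b → R a c → R b c → ∀ i j → i ≢ j → R ((a ∷ b ∷ c ∷ []) i) ((a ∷ b ∷ c ∷ []) j)
pairwise3 R-sym ab ac bc zero                zero                i≢j = ⊥-elim (i≢j refl)
pairwise3 R-sym ab ac bc zero                (suc zero)          _   = ab
pairwise3 R-sym ab ac bc zero                (suc (suc zero))    _   = ac
pairwise3 R-sym ab ac bc (suc zero)          zero                _   = R-sym ab
pairwise3 R-sym ab ac bc (suc zero)          (suc zero)          i≢j = ⊥-elim (i≢j refl)
pairwise3 R-sym ab ac bc (suc zero)          (suc (suc zero))    _   = bc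
pairwise3 R-sym ab ac bc (suc (suc zero))    zero                _   = R-sym ac
pairwise3 R-sym ab ac bc (suc (suc zero))    (suc zero)          _   = R-sym bc
pairwise3 R-sym ab ac bc (suc (suc zero))    (suc (suc zero))    i≢j = ⊥-elim (i≢j refl)

spans-edge : {G : Graph n} → CliqueNumberLT (complement G) 3 → ∀ {x y z} →
  x ≢ y → x ≢ z → y ≢ z → Adj G x y ⊎ Adj G x z ⊎ Adj G y z
spans-edge {G = G} noIndependent {x} {y} {z} x≢y x≢z y≢z
  with adj G x y in xy | adj G x z in xz | adj G y z in yz
... | true  | _     | _     = inj₁ refl
... | false | true  | _     = inj₂ (inj₁ refl)
... | false | false | true  = inj₂ (inj₂ refl)
... | false | false | false = ⊥-elim (noIndependent (_ , pairwise3 {R = Adj (complement G)}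
      (λ {u} {v} e → trans (Graph.sym (complement G) v u) e)
      (complement-adj {G = G} x≢y xy) (complement-adj {G = G} x≢z xz)
      (complement-adj {G = G} y≢z yz)))

-- α(G) ≤ 2 and |V(G)| > 2r give G →v (2_r): some colour class has three
-- vertices, and they span an edge.
arrow-from-α≤2 : {G : Graph n} → CliqueNumberLT (complement G) 3 → 2 * r < n → VArrow G r
arrow-from-α≤2 {n = n} {r = r} {G} noIndependent large c with monoTriple r n large c
... | triple x y z x≢y x≢z y≢z cx≡cy cx≡cz with spans-edge {G = G} noIndependent x≢y x≢z y≢z
...   | inj₁ xy          = x , y , xy , cx≡cy
...   | inj₂ (inj₁ xz)   = x , z , xz , cx≡cz
...   | inj₂ (inj₂ yz)   = y , z , yz , trans (sym cx≡cy) cx≡cz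

allFin : (Fin n → Bool) → Bool
allFin {zero}  p = true
allFin {suc n} p = p zero ∧ allFin (p ∘ suc)

allFin-sound : (p : Fin n → Bool) → allFin p ≡ true → ∀ i → p i ≡ true
allFin-sound {suc n} p holds i with p zero in p₀
allFin-sound {suc n} p holds zero    | true = p₀
allFin-sound {suc n} p holds (suc i) | true = allFin-sound (p ∘ suc) holds i

cliqueFree : Graph n → ℕ → (Fin n → Bool) → Bool
cliqueFree G zero    allowed = false
cliqueFree G (suc k) allowed =
  allFin λ v → not (allowed v) ∨ cliqueFree G k (λ u → allowed u ∧ adj G v u)

cliqueFree-sound : (G : Graph n) → ∀ k allowed → cliqueFree G k allowed ≡ true →
  (f : Fin k → Fin n) → IsClique G f → (∀ i → allowed (f i) ≡ true) → ⊥
cliqueFree-sound G (suc k) allowed free f clique inside =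
  cliqueFree-sound G k _ (restrict (allFin-sound _ free (f zero)) (inside zero)) (f ∘ suc)
    (λ i j i≢j → clique (suc i) (suc j) (i≢j ∘ suc-injective))
    (λ i → both (inside (suc i)) (clique zero (suc i) λ ()))
  where
  restrict : ∀ {a b} → not a ∨ b ≡ true → a ≡ true → b ≡ true
  restrict holds refl = holds
  both : ∀ {a b} → a ≡ true → b ≡ true → a ∧ b ≡ true
  both refl refl = refl

cliqueFree⇒ω< : (G : Graph n) → cliqueFree G k (λ _ → true) ≡ true → CliqueNumberLT G k
cliqueFree⇒ω< {k = k} G free (f , clique) = cliqueFree-sound G k _ free f clique λ _ → refl

distanceGraph : (N : ℕ) (S : ℕ → Bool) → S 0 ≡ false → Graph N
distanceGraph N S S0 = record
  { adj    = λ u v → S ∣ toℕ u - toℕ v ∣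
  ; sym    = λ u v → cong S (∣-∣-comm (toℕ u) (toℕ v))
  ; irrefl = λ v → trans (cong S (∣n-n∣≡0 (toℕ v))) S0 }

K₁ : Graph 1
K₁ = distanceGraph 1 (λ _ → false) refl

C₅ : Graph 5
C₅ = distanceGraph 5 cycleDistance refl
  where
  cycleDistance : ℕ → Bool
  cycleDistance 1 = true
  cycleDistance 4 = true
  cycleDistance _ = false

-- The circulant graph on ℤ₁₃ with connection set {±2, ±3, ±4, ±6}.
Q : Graph 13
Q = distanceGraph 13 qDistance refl
  where
  qDistance : ℕ → Bool
  qDistance 2  = true
  qDistance 3  = true
  qDistance 4  = true
  qDistance 6  = true
  qDistance 7  = true
  qDistance 9  = true
  qDistance 10 = true
  qDistance 11 = true
  qDistance _  = false

K₁-ω : CliqueNumberLT K₁ 2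
K₁-ω = cliqueFree⇒ω< K₁ refl

C₅-ω : CliqueNumberLT C₅ 3
C₅-ω = cliqueFree⇒ω< C₅ refl

Q-ω : CliqueNumberLT Q 5
Q-ω = cliqueFree⇒ω< Q refl

Q-α : CliqueNumberLT (complement Q) 3
Q-α = cliqueFree⇒ω< (complement Q) refl

Q-arrow : VArrow Q 6
Q-arrow = arrow-from-α≤2 {G = Q} Q-α (s≤s ≤-refl)

K₁-forces1 : ForcesColours K₁ 1
K₁-forces1 c = inj₂ ((λ _ → zero) , λ { zero zero i≢j → ⊥-elim (i≢j refl) })

rainbow : (c : Fin n → Fin p) {a b d : Fin n} → c a ≢ c b → c a ≢ c d → c b ≢ c d →
  Distinct (c ∘ (a ∷ b ∷ d ∷ []))
rainbow c = pairwise3 {R = λ u v → c u ≢ c v} ≢-sym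

v₀ v₁ v₂ v₃ v₄ : Fin 5
v₀ = zero
v₁ = suc zero
v₂ = suc (suc zero)
v₃ = suc (suc (suc zero))
v₄ = suc (suc (suc (suc zero)))

-- χ(C₅) = 3: a colouring of C₅ without monochromatic edge uses three
-- distinct colours on v₀, v₁ and one of v₂, v₃, v₄.
C₅-forces3 : ForcesColours C₅ 3
C₅-forces3 c with c v₀ ≟ c v₁ | c v₁ ≟ c v₂ | c v₂ ≟ c v₃ | c v₃ ≟ c v₄ | c v₄ ≟ c v₀
... | yes e | _     | _     | _     | _     = inj₁ (v₀ , v₁ , refl , e)
... | no _  | yes e | _     | _     | _     = inj₁ (v₁ , v₂ , refl , e)
... | no _  | no _  | yes e | _     | _     = inj₁ (v₂ , v₃ , refl , e)
... | no _  | no _  | no _  | yes e | _     = inj₁ (v₃ , v₄ , refl , e)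
... | no _  | no _  | no _  | no _  | yes e = inj₁ (v₄ , v₀ , refl , e)
... | no c₀₁ | no c₁₂ | no c₂₃ | no c₃₄ | no c₄₀ with c v₀ ≟ c v₂ | c v₁ ≟ c v₃
...   | no c₀₂  | _       = inj₂ (_ , rainbow c c₀₁ c₀₂ c₁₂)
...   | yes c₀₂ | no c₁₃  = inj₂ (_ , rainbow c c₀₁ (λ c₀₃ → c₂₃ (trans (sym c₀₂) c₀₃)) c₁₃)
...   | yes c₀₂ | yes c₁₃ = inj₂ (_ , rainbow c c₀₁ (≢-sym c₄₀) (λ c₁₄ → c₃₄ (trans (sym c₁₃) c₁₄)))

witnessGraph : ∀ s t → Graph (stack 1 t (stack 5 s 13))
witnessGraph s t = joinPower K₁ t (joinPower C₅ s Q)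

witness-arrow : ∀ s t → VArrow (witnessGraph s t) (stack 1 t (stack 3 s 6))
witness-arrow s t = joinPower-arrow K₁-forces1 (joinPower-arrow C₅-forces3 Q-arrow s) t

witness-ω : ∀ s t → CliqueNumberLT (witnessGraph s t) (suc (stack 1 t (stack 2 s 4)))
witness-ω s t = joinPower-ω K₁-ω (joinPower-ω C₅-ω Q-ω s) t

stack₂-≡ : ∀ a t b s c → stack a t (stack b s c) ≡ t * a + (s * b + c)
stack₂-≡ a t b s c = trans (stack-≡ a t _) (cong (t * a +_) (stack-≡ b s c))

witness-size : ∀ s t → stack 1 t (stack 5 s 13) ≡ t + (3 * s + 6) + 2 * s + 7
witness-size s t = trans (stack₂-≡ 1 t 5 s 13) (normalise s t)
  where
  normalise : ∀ s t → t * 1 + (s * 5 + 13) ≡ t + (3 * s + 6) + 2 * s + 7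
  normalise = solve-∀

witness-colours : ∀ s t → stack 1 t (stack 3 s 6) ≡ t + (3 * s + 6)
witness-colours s t = trans (stack₂-≡ 1 t 3 s 6) (normalise s t)
  where
  normalise : ∀ s t → t * 1 + (s * 3 + 6) ≡ t + (3 * s + 6)
  normalise = solve-∀

witness-clique : ∀ s t → suc (stack 1 t (stack 2 s 4)) ≡ t + (3 * s + 6) ∸ s ∸ 1
witness-clique s t = begin
  suc w                          ≡⟨ cong (_∸ 1) (m+n∸m≡n s (2 + w)) ⟨
  s + (2 + w) ∸ s ∸ 1            ≡⟨ cong (λ x → x ∸ s ∸ 1) (trans (cong (λ x → s + (2 + x)) (stack₂-≡ 1 t 2 s 4)) (normalise s t)) ⟩
  t + (3 * s + 6) ∸ s ∸ 1        ∎
  where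
  open ≡-Reasoning
  w : ℕ
  w = stack 1 t (stack 2 s 4)
  normalise : ∀ s t → s + (2 + (t * 1 + (s * 2 + 4))) ≡ t + (3 * s + 6)
  normalise = solve-∀

witness : ∀ s t → FvLE (t + (3 * s + 6)) (t + (3 * s + 6) ∸ s ∸ 1) (t + (3 * s + 6) + 2 * s + 7)
witness s t = _ , ≤-reflexive (witness-size s t) , witnessGraph s t ,
  subst (VArrow (witnessGraph s t)) (witness-colours s t) (witness-arrow s t) ,
  subst (CliqueNumberLT (witnessGraph s t)) (witness-clique s t) (witness-ω s t)

theorem3p1 : (r s : ℕ) → 3 * s + 6 ≤ r →
    FvLE r (r ∸ s ∸ 1) (r + 2 * s + 7)
theorem3p1 r s 3s+6≤r =
  subst (λ r → FvLE r (r ∸ s ∸ 1) (r + 2 * s + 7)) (m∸n+n≡m 3s+6≤r) (witness s (r ∸ (3 * s + 6)))
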